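{- (b) There exist a finite alphabet $A$, an integer $n\ge1$ and $n$-variable quasi-regular predicates $P,Q$ over $A$ such that $P\wedge Q$ (the intersection of the corresponding languages) is not quasi-regular. (c) There exist a finite alphabet $A$, an integer $n\ge1$ and $n$-variable quasi-regular predicates $P,Q$ over $A$ such that $P\vee Q$ (the union) is not quasi-regular. (d) For every finite alphabet $A$, every $n\ge2$ and every $n$-variable quasi-regular predicate $P$ over $A$, the predicate $(\exists x_1)P(x_1,\dots,x_n)$ is weakly regular; but there exist $A$, $n\ge2$ and a quasi-regular $P$ for which $(\exists x_1)P(x_1,\dots,x_n)$ is not quasi-regular. (e) There exist a finite alphabet $A$, $n\ge2$ and an $n$-variable quasi-regular predicate $P$ over $A$ such that $(\forall x_1)P(x_1,\dots,x_n)$ is not quasi-regular.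
   Context: An $n$-variable predicate over $A$ is identified with the set $L\subseteq(A^\ast)^n$ of tuples where it holds. $(\exists x_1)P$ is the $(n-1)$-variable predicate $\{(x_2,\dots,x_n):\exists x_1\in A^\ast,\ P(x_1,\dots,x_n)\}$ and $(\forall x_1)P$ is $\{(x_2,\dots,x_n):\forall x_1\in A^\ast,\ P(x_1,\dots,x_n)\}$. Let $\$\notin A$. An $n$-tape semi-sorted asynchronous automaton over $A$ is a partial deterministic finite state automaton (unique start state, no $\epsilon$-transitions, at most one transition per state and letter) over $A\sqcup\{\$\}$ with a partition of its states into $S_1,\dots,S_n$; it accepts $(w_1,\dots,w_n)$ iff there is a path from the start state to an accept state such that for each $i$ the concatenation of labels of transitions whose source lies in $S_i$ equals $w_i\$$. A predicate is quasi-regular if its language is accepted by such an automaton. A non-deterministic semi-sorted asynchronous automaton (SAA) is defined the same way but from a non-deterministic finite state automaton over $A\sqcup\{\$\}$ (several start states, several transitions per letter, and $\epsilon$-transitions allowed; $\epsilon$-labels are ignored in the concatenations). A predicate is weakly regular if its language is accepted by an SAA. -}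

module Defs where

open import Data.Nat using (ℕ; suc)
open import Data.Fin using (Fin; _≟_)
open import Data.Bool using (Bool; true)
open import Data.Maybe using (Maybe; just; nothing)
open import Data.List using (List; []; _∷_; _++_; map)
open import Data.Vec using (Vec; _∷_; lookup)
open import Data.Product using (Σ; _×_; _,_)
open import Data.Sum using (_⊎_)
open import Relation.Nullary using (does)
open import Relation.Binary.PropositionalEquality using (_≡_)

data Sym (k : ℕ) : Set where
  sym    : Fin k → Sym k
  dollar : Sym k

-- An n-variable predicate over A = Fin k, identified with its language
-- (a subset of (A*)^n, given as a Set-valued predicate on n-tuples of words).
Pred : ℕ → ℕ → Set₁
Pred k n = Vec (List (Fin k)) n → Set

_∧ₚ_ : ∀ {k n} → Pred k n → Pred k n → Pred k n
(P ∧ₚ Q) w = P w × Q w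

_∨ₚ_ : ∀ {k n} → Pred k n → Pred k n → Pred k n
(P ∨ₚ Q) w = P w ⊎ Q w

∃₁ : ∀ {k n} → Pred k (suc n) → Pred k n
∃₁ {k} P ws = Σ (List (Fin k)) (λ x → P (x ∷ ws))

∀₁ : ∀ {k n} → Pred k (suc n) → Pred k n
∀₁ {k} P ws = (x : List (Fin k)) → P (x ∷ ws)

-- Paths in a transition system, recorded as the list of
-- (source state, label) of the transitions taken.
data Path {S L : Set} (step : S → L → S → Set) : S → S → List (S × L) → Set where
  nil  : ∀ {q} → Path step q q []
  cons : ∀ {q l q' r ts} → step q l q' → Path step q' r ts →
         Path step q r ((q , l) ∷ ts)

-- Concatenation of the labels of transitions whose source lies in S_i
-- (S_i = states mapped to i by the partition map `part`).
project : ∀ {S L : Set} {n k} → (S → Fin n) → (L → List (Sym k)) →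
          Fin n → List (S × L) → List (Sym k)
project part lab i [] = []
project part lab i ((s , l) ∷ ts) with does (part s ≟ i)
... | true  = lab l ++ project part lab i ts
... | _     = project part lab i ts

withDollar : ∀ {k} → List (Fin k) → List (Sym k)
withDollar w = map sym w ++ (dollar ∷ [])

record DSAA (k n : ℕ) : Set where
  field
    states : ℕ
    start  : Fin states
    δ      : Fin states → Sym k → Maybe (Fin states)
    accept : Fin states → Bool
    part   : Fin states → Fin n

DStep : ∀ {k n} (D : DSAA k n) → Fin (DSAA.states D) → Sym k → Fin (DSAA.states D) → Set
DStep D q a q' = DSAA.δ D q a ≡ just q'

DAccepts : ∀ {k n} → DSAA k n → Pred k n
DAccepts {k} D ws =
  Σ (Fin (DSAA.states D)) λ q →
  Σ (List (Fin (DSAA.states D) × Sym k)) λ ts →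
    Path (DStep D) (DSAA.start D) q ts × DSAA.accept D q ≡ true ×
    ((i : Fin _) → project (DSAA.part D) (λ a → a ∷ []) i ts ≡ withDollar (lookup ws i))

-- non-deterministic semi-sorted asynchronous automaton (ε-transitions = label nothing)
record SAA (k n : ℕ) : Set where
  field
    states : ℕ
    start  : Fin states → Bool
    trans  : Fin states → Maybe (Sym k) → Fin states → Bool
    accept : Fin states → Bool
    part   : Fin states → Fin n

NStep : ∀ {k n} (N : SAA k n) → Fin (SAA.states N) → Maybe (Sym k) → Fin (SAA.states N) → Set
NStep N q a q' = SAA.trans N q a q' ≡ true

labelOf : ∀ {k} → Maybe (Sym k) → List (Sym k)
labelOf (just a) = a ∷ []
labelOf nothing  = []

NAccepts : ∀ {k n} → SAA k n → Pred k n
NAccepts {k} N ws =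
  Σ (Fin (SAA.states N)) λ q₀ →
  Σ (Fin (SAA.states N)) λ q →
  Σ (List (Fin (SAA.states N) × Maybe (Sym k))) λ ts →
    SAA.start N q₀ ≡ true ×
    Path (NStep N) q₀ q ts × SAA.accept N q ≡ true ×
    ((i : Fin _) → project (SAA.part N) labelOf i ts ≡ withDollar (lookup ws i))

_Recognises_ : ∀ {k n} → Pred k n → Pred k n → Set
Acc Recognises P = ∀ ws → (P ws → Acc ws) × (Acc ws → P ws)

QuasiRegular : ∀ {k n} → Pred k n → Set
QuasiRegular {k} {n} P = Σ (DSAA k n) λ D → DAccepts D Recognises P

WeaklyRegular : ∀ {k n} → Pred k n → Set
WeaklyRegular {k} {n} P = Σ (SAA k n) λ N → NAccepts N Recognises P

module Submission where

-- The core is a pumping lemma for deterministic semi-sorted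
-- asynchronous automata (Pumping.pump-down).  If D accepts a tuple whose words
-- all begin with cᴺ, N = 1 + #states, then by pigeonhole its run repeats a
-- state while still inside the padding (find-cycle); by determinism every
-- other accepted tuple of the same shape is read through the same cycle
-- (run-prefix, run-suffix), so cutting the cycle out shortens the paddings of
-- all such tuples uniformly, and not all by zero.  Applied to the
-- quasi-regular predicates LeftCopy = {(aⁱbaʲ , aⁱ)} and RightCopy =
-- {(aⁱbaʲ , aʲ)} this shows that their intersection and union are not
-- quasi-regular.  For (d) and (e), Switch (x , u , v) = "LeftCopy (u , v) if
-- x = [], RightCopy (u , v) otherwise" is quasi-regular, while (∃x) Switch
-- and (∀x) Switch are exactly that union and intersection.
--
-- Positive part of (d).  An SAA for (∃x₁) P simulates a deterministic
-- automaton for P, replacing its moves on tape x₁ by ε-moves that guess the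
-- letter read (ExistentialProjection).

open import Defs
open import Data.Nat using (ℕ; zero; suc; _+_; _∸_; _≤_; _<_; z≤n; s≤s)
open import Data.Nat.Properties
  using (≤-trans; ≤-reflexive; <-≤-trans; ≤-pred; m≤m+n; m≤n+m; m<m+n; m≤n⇒m≤1+n; +-assoc; +-comm; +-suc;
         suc-injective; +-monoˡ-≤; +-cancelʳ-≡; <-irrefl; 1+n≰n; m+1+n≰m; m≤n⇒m⊓n≡m; m+[n∸m]≡n;
         m<n⇒0<n∸m; module ≤-Reasoning)
open import Data.Fin using (Fin; zero; suc; _≟_; splitAt; join)
import Data.Fin.Properties as FinP
open import Data.Bool using (Bool; true; false; _∧_)
import Data.Bool.Properties as BoolP
open import Data.Maybe using (Maybe; just; nothing)
import Data.Maybe.Properties as MaybeP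
open import Data.List using (List; []; _∷_; _++_; [_]; map; length; replicate; take; drop; filter; allFin)
open import Data.List.Properties
  using (++-assoc; ++-cancelˡ; ++-cancelʳ; ++-identityʳ; map-injective; length-++; length-replicate; length-take; take++drop≡id;
         ∷-injectiveˡ; ∷-injectiveʳ; filter-notAll; length-tabulate)
open import Data.List.Relation.Unary.Any using (Any; here; there; any?)
import Data.List.Relation.Unary.Any as Any
import Data.List.Relation.Unary.All as All
open import Data.List.Relation.Unary.All using (All; []; _∷_)
open import Data.List.Membership.Propositional using (_∈_; find)
open import Data.List.Membership.Propositional.Properties using (∈-filter⁺; ∈-allFin; ∈-∃++)
open import Data.Vec using (Vec; []; _∷_; tabulate; lookup)
open import Data.Vec.Properties using (lookup∘tabulate)
open import Data.Product using (Σ; _×_; _,_; proj₁; proj₂)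
open import Data.Sum using (_⊎_; inj₁; inj₂; [_,_]′)
import Data.Product.Properties as ProdP
open import Data.Empty using (⊥; ⊥-elim)
open import Relation.Nullary using (¬_; Dec; yes; no; does; ¬?)
open import Relation.Nullary.Decidable using (map′; _×-dec_; _⊎-dec_; dec-true)
open import Function using (_∘_)
open import Relation.Binary.PropositionalEquality
  using (_≡_; _≢_; refl; trans; cong; cong₂; subst; subst₂; module ≡-Reasoning)
  renaming (sym to ≡-sym)

module _ {S L : Set} {step : S → L → S → Set} where

  path-++ : ∀ {q r t xs ys} → Path step q r xs → Path step r t ys → Path step q t (xs ++ ys)
  path-++ nil      p′ = p′
  path-++ (cons s p) p′ = cons s (path-++ p p′)

  path-split : ∀ {q t} xs {ys} → Path step q t (xs ++ ys) →
               Σ S λ r → Path step q r xs × Path step r t ys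
  path-split []       p          = _ , nil , p
  path-split (_ ∷ xs) (cons s p) =
    let r , p₁ , p₂ = path-split xs p in r , cons s p₁ , p₂

  path-source : ∀ {q t q′ l ts} → Path step q t ((q′ , l) ∷ ts) → q ≡ q′
  path-source (cons _ _) = refl

module _ {S L : Set} {n k : ℕ} (part : S → Fin n) (lab : L → List (Sym k)) where

  project-++ : ∀ i xs ys → project part lab i (xs ++ ys) ≡ project part lab i xs ++ project part lab i ys
  project-++ i []             ys = refl
  project-++ i ((s , l) ∷ xs) ys with part s ≟ i
  ... | yes _ = trans (cong (lab l ++_) (project-++ i xs ys)) (≡-sym (++-assoc (lab l) _ _))
  ... | no  _ = project-++ i xs ys

  project-here : ∀ {s l i} ts → part s ≡ i →
                 project part lab i ((s , l) ∷ ts) ≡ lab l ++ project part lab i ts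
  project-here {s} {i = i} ts e with part s ≟ i
  ... | yes _ = refl
  ... | no ne = ⊥-elim (ne e)

  project-elsewhere : ∀ {s l i} ts → part s ≢ i →
                      project part lab i ((s , l) ∷ ts) ≡ project part lab i ts
  project-elsewhere {s} {i = i} ts ne with part s ≟ i
  ... | yes e = ⊥-elim (ne e)
  ... | no _  = refl

  project-silent : ∀ {s l i} ts → lab l ≡ [] →
                   project part lab i ((s , l) ∷ ts) ≡ project part lab i ts
  project-silent {s} {i = i} ts e with part s ≟ i
  ... | yes _ = cong (_++ project part lab i ts) e
  ... | no  _ = refl

project-cons-cong :
  ∀ {S S′ L L′ : Set} {n n′ k} {part : S → Fin n} {part′ : S′ → Fin n′}
    {lab : L → List (Sym k)} {lab′ : L′ → List (Sym k)} {i i′ s s′ l l′ ts ts′} →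
  (part s ≡ i → part′ s′ ≡ i′) → (part′ s′ ≡ i′ → part s ≡ i) → lab l ≡ lab′ l′ →
  project part lab i ts ≡ project part′ lab′ i′ ts′ →
  project part lab i ((s , l) ∷ ts) ≡ project part′ lab′ i′ ((s′ , l′) ∷ ts′)
project-cons-cong {part = part} {part′} {i = i} {i′} {s} {s′} to from el e with part s ≟ i | part′ s′ ≟ i′
... | yes _  | yes _  = cong₂ _++_ el e
... | no  _  | no  _  = e
... | yes p  | no ¬p′ = ⊥-elim (¬p′ (to p))
... | no ¬p  | yes p′ = ⊥-elim (¬p (from p′))

module _ {T : Set} {s : ℕ} (key : T → Fin s) where

  Repeat : List T → Set
  Repeat xs = Σ (List T) λ α → Σ T λ y → Σ (List T) λ β → Σ T λ y′ → Σ (List T) λ γ →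
              xs ≡ α ++ y ∷ β ++ y′ ∷ γ × key y ≡ key y′

  -- Induction on the list, shrinking the set U of keys still available.
  repeat-within : (U : List (Fin s)) (xs : List T) →
                  All (λ y → key y ∈ U) xs → length U < length xs → Repeat xs
  repeat-within U (y ∷ xs) (y∈U ∷ xs⊆U) U<y∷xs with any? (λ y′ → key y ≟ key y′) xs
  ... | yes y∼xs =
    let y′ , y′∈xs , ky≡ky′ = find y∼xs
        β , γ , xs≡ = ∈-∃++ y′∈xs
    in [] , y , β , y′ , γ , cong (y ∷_) xs≡ , ky≡ky′
  ... | no fresh =
    let α , z , β , z′ , γ , xs≡ , kz≡kz′ = repeat-within U′ xs (restrict xs xs⊆U fresh) U′<xs
    in y ∷ α , z , β , z′ , γ , cong (y ∷_) xs≡ , kz≡kz′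
    where
      other? = λ u → ¬? (key y ≟ u)
      U′ = filter other? U
      restrict : ∀ zs → All (λ z → key z ∈ U) zs → ¬ Any (λ z → key y ≡ key z) zs →
                 All (λ z → key z ∈ U′) zs
      restrict []       []          _   = []
      restrict (z ∷ zs) (z∈U ∷ zs⊆U) new =
        ∈-filter⁺ other? z∈U (λ e → new (here e)) ∷ restrict zs zs⊆U (λ a → new (there a))
      U′<xs : length U′ < length xs
      U′<xs = <-≤-trans (filter-notAll other? U (Any.map (λ e ne → ne e) y∈U)) (≤-pred U<y∷xs)

  pigeonhole : (xs : List T) → s < length xs → Repeat xs
  pigeonhole xs s<xs =
    repeat-within (allFin s) xs (All.tabulate (λ {y} _ → ∈-allFin (key y)))
                  (subst (_< length xs) (≡-sym (length-tabulate (λ i → i))) s<xs)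

  -- The repetition already occurs among the first s+1 entries, so the
  -- segment up to the second occurrence has length at most s.
  early-repeat : (xs : List T) → s < length xs →
    Σ (List T) λ α → Σ T λ y → Σ (List T) λ β → Σ T λ y′ → Σ (List T) λ γ →
      xs ≡ α ++ y ∷ β ++ y′ ∷ γ × key y ≡ key y′ × length (α ++ y ∷ β) ≤ s
  early-repeat xs s<xs =
    let α , y , β , y′ , γ , pre≡ , ky≡ky′ = pigeonhole pre (≤-reflexive (≡-sym |pre|))
    in α , y , β , y′ , γ ++ post , xs-split α y β y′ γ pre≡ , ky≡ky′ , short α y β y′ γ pre≡
    where
      pre = take (suc s) xs
      post = drop (suc s) xs
      |pre| : length pre ≡ suc s
      |pre| = trans (length-take (suc s) xs) (m≤n⇒m⊓n≡m s<xs)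
      xs-split : ∀ α y β y′ γ → pre ≡ α ++ y ∷ β ++ y′ ∷ γ → xs ≡ α ++ y ∷ β ++ y′ ∷ (γ ++ post)
      xs-split α y β y′ γ pre≡ = begin
        xs                                    ≡⟨ ≡-sym (take++drop≡id (suc s) xs) ⟩
        pre ++ post                           ≡⟨ cong (_++ post) pre≡ ⟩
        (α ++ y ∷ β ++ y′ ∷ γ) ++ post        ≡⟨ ++-assoc α _ post ⟩
        α ++ y ∷ (β ++ y′ ∷ γ) ++ post        ≡⟨ cong (λ z → α ++ y ∷ z) (++-assoc β _ post) ⟩
        α ++ y ∷ β ++ y′ ∷ (γ ++ post)        ∎
        where open ≡-Reasoning
      short : ∀ α y β y′ γ → pre ≡ α ++ y ∷ β ++ y′ ∷ γ → length (α ++ y ∷ β) ≤ s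
      short α y β y′ γ pre≡ = subst (length (α ++ y ∷ β) ≤_) L+|γ|≡s (m≤m+n _ (length γ))
        where
          L = length (α ++ y ∷ β)
          L+|γ|≡s : L + length γ ≡ s
          L+|γ|≡s = suc-injective (begin
            suc (L + length γ)                  ≡⟨ ≡-sym (+-suc L _) ⟩
            L + length (y′ ∷ γ)                 ≡⟨ ≡-sym (length-++ (α ++ y ∷ β)) ⟩
            length ((α ++ y ∷ β) ++ y′ ∷ γ)     ≡⟨ cong length (++-assoc α (y ∷ β) (y′ ∷ γ)) ⟩
            length (α ++ y ∷ β ++ y′ ∷ γ)       ≡⟨ cong length (≡-sym pre≡) ⟩
            length pre                          ≡⟨ |pre| ⟩
            suc s                               ∎)
            where open ≡-Reasoning

module _ {A : Set} (x : A) where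

  replicate-+ : ∀ m n → replicate (m + n) x ≡ replicate m x ++ replicate n x
  replicate-+ zero    n = refl
  replicate-+ (suc m) n = cong (x ∷_) (replicate-+ m n)

  length-power : ∀ N ys → N ≤ length (replicate N x ++ ys)
  length-power zero    ys = z≤n
  length-power (suc N) ys = s≤s (length-power N ys)

  prefix-of-power : ∀ {N} xs {ys zs} → length xs ≤ N →
                    xs ++ ys ≡ replicate N x ++ zs → xs ≡ replicate (length xs) x
  prefix-of-power []       _        _ = refl
  prefix-of-power (_ ∷ xs) (s≤s le) e = cong₂ _∷_ (∷-injectiveˡ e) (prefix-of-power xs le (∷-injectiveʳ e))

  power-++ : ∀ m t zs → replicate m x ++ replicate t x ++ zs ≡ replicate (m + t) x ++ zs
  power-++ m t zs = trans (≡-sym (++-assoc (replicate m x) _ zs)) (cong (_++ zs) (≡-sym (replicate-+ m t)))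

  cancel-power : ∀ m t {ys zs} → replicate m x ++ ys ≡ replicate (m + t) x ++ zs →
                 ys ≡ replicate t x ++ zs
  cancel-power m t {ys} {zs} e = ++-cancelˡ (replicate m x) ys _ (trans e (≡-sym (power-++ m t zs)))

padded : ∀ {k n} → Fin k → (Fin n → ℕ) → (Fin n → List (Fin k)) → Vec (List (Fin k)) n
padded c e r = tabulate λ i → replicate (e i) c ++ r i

padded-tape : ∀ {k n} (c : Fin k) e r (i : Fin n) →
              withDollar (lookup (padded c e r) i) ≡ replicate (e i) (sym c) ++ withDollar (r i)
padded-tape c e r i = trans (cong withDollar (lookup∘tabulate _ i)) (power-sym (e i) (r i))
  where
    power-sym : ∀ m w → withDollar (replicate m c ++ w) ≡ replicate m (sym c) ++ withDollar w
    power-sym zero    w = refl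
    power-sym (suc m) w = cong (sym c ∷_) (power-sym m w)

module Deterministic {k n : ℕ} (D : DSAA k n) where
  open DSAA D

  Trace : Set
  Trace = List (Fin states × Sym k)

  Run : Fin states → Fin states → Trace → Set
  Run = Path (DStep D)

  tape : Fin n → Trace → List (Sym k)
  tape = project part [_]

  tape-length : ∀ i ts → length (tape i ts) ≤ length ts
  tape-length i []             = z≤n
  tape-length i ((q , _) ∷ ts) with part q ≟ i
  ... | yes _ = s≤s (tape-length i ts)
  ... | no  _ = m≤n⇒m≤1+n (tape-length i ts)

  source-tape-reads : ∀ q a ts → 1 ≤ length (tape (part q) ((q , a) ∷ ts))
  source-tape-reads q a ts = subst (λ w → 1 ≤ length w) (≡-sym (project-here part [_] ts refl)) (s≤s z≤n)

  -- Determinism: the state reached is a function of the trace.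
  run-suffix : ∀ {q r t xs ys} → Run q r xs → Run q t (xs ++ ys) → Run r t ys
  run-suffix nil        p′           = p′
  run-suffix (cons s p) (cons s′ p′) with trans (≡-sym s) s′
  ... | refl = run-suffix p p′

  _≼_ : List (Sym k) → List (Sym k) → Set
  xs ≼ ys = Σ (List (Sym k)) λ zs → xs ++ zs ≡ ys

  source-tape-nonempty : ∀ {q a ts} → ¬ (tape (part q) ((q , a) ∷ ts) ≼ [])
  source-tape-nonempty {q} (_ , e) with part q ≟ part q
  ... | yes _ with e
  ...   | ()
  source-tape-nonempty {q} _ | no ne = ne refl

  first-letters-agree : ∀ {q a b ts ts′} →
    tape (part q) ((q , a) ∷ ts) ≼ tape (part q) ((q , b) ∷ ts′) → a ≡ b
  first-letters-agree {q} (_ , e) with part q ≟ part q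
  ... | yes _ = ∷-injectiveˡ e
  ... | no ne = ⊥-elim (ne refl)

  drop-first-transition : ∀ {q a ts ts′} i →
    tape i ((q , a) ∷ ts) ≼ tape i ((q , a) ∷ ts′) → tape i ts ≼ tape i ts′
  drop-first-transition {q} i (zs , e) with part q ≟ i
  ... | yes _ = zs , ∷-injectiveʳ e
  ... | no  _ = zs , e

  -- Determinism: the trace is a function of the tape contents.
  run-prefix : ∀ {q r r′ ts ts′} → Run q r ts → Run q r′ ts′ →
               (∀ i → tape i ts ≼ tape i ts′) → Σ Trace λ us → ts ++ us ≡ ts′
  run-prefix {ts′ = ts′} nil _ _ = ts′ , refl
  run-prefix {q} (cons _ _) nil pre = ⊥-elim (source-tape-nonempty (pre (part q)))
  run-prefix {q} (cons s p) (cons s′ p′) pre with first-letters-agree (pre (part q))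
  ... | refl with trans (≡-sym s) s′
  ... | refl =
    let us , e = run-prefix p p′ (λ i → drop-first-transition i (pre i)) in us , cong (_ ∷_) e

  record Cycle (q : Fin states) (ts : Trace) : Set where
    field
      pivot              : Fin states
      before loop after  : Trace
      split              : ts ≡ before ++ loop ++ after
      early              : length (before ++ loop) ≤ states
      loop-reads        : Σ (Fin n) λ i → 1 ≤ length (tape i loop)
      run-before         : Run q pivot before
      run-loop           : Run pivot pivot loop

  find-cycle : ∀ {q r} ts → Run q r ts → states < length ts → Cycle q ts
  find-cycle ts p long with early-repeat proj₁ ts long
  ... | α , (q₁ , a) , β , (.q₁ , b) , γ , refl , refl , short with path-split α p
  ... | x₁ , p-before , p-rest with path-source p-rest
  ... | refl with path-split ((q₁ , a) ∷ β) p-rest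
  ... | x₂ , p-loop , p-after with path-source p-after
  ... | refl = record
    { pivot = q₁ ; before = α ; loop = (q₁ , a) ∷ β ; after = (q₁ , b) ∷ γ
    ; split = refl ; early = short ; loop-reads = part q₁ , source-tape-reads q₁ a β
    ; run-before = p-before ; run-loop = p-loop }

-- If D accepts a tuple whose words all
-- begin with c^N, a cycle read inside the padding can be cut out: there are
-- lengths len i ≤ N, all positive and one of them < N, such that shortening
-- the padding c^N of tape i to c^(len i) preserves acceptance of EVERY tuple
-- of this shape (determinism forces all such runs through the same cycle).
module Pumping {k n : ℕ} (D : DSAA k (suc n)) where
  open DSAA D
  open Deterministic D

  N : ℕ
  N = suc states

  record Shortening (c : Fin k) : Set where
    field
      len      : Fin (suc n) → ℕ
      bounded  : ∀ i → len i ≤ N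
      positive : ∀ i → 1 ≤ len i
      shorter  : Σ (Fin (suc n)) λ i → len i < N
      transfer : ∀ r → DAccepts D (padded c (λ _ → N) r) → DAccepts D (padded c len r)

  -- The construction is abstract: its uses need only the fields of the
  -- shortening, and unfolding the cycle search there is prohibitively costly.
  abstract
    pump-down : ∀ c r → DAccepts D (padded c (λ _ → N) r) → Shortening c
    pump-down c r (_ , ts , run , _ , tapes) = record
      { len = len ; bounded = bounded ; positive = positive ; shorter = shorter ; transfer = transfer }
      where
        cs : ℕ → List (Sym k)
        cs m = replicate m (sym c)

        padded-reads : ∀ r′ ts′ → (∀ i → tape i ts′ ≡ withDollar (lookup (padded c (λ _ → N) r′) i)) →
                       ∀ i → tape i ts′ ≡ cs N ++ withDollar (r′ i)
        padded-reads r′ ts′ tapes′ i = trans (tapes′ i) (padded-tape c (λ _ → N) r′ i)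

        reads : ∀ i → tape i ts ≡ cs N ++ withDollar (r i)
        reads = padded-reads r ts tapes

        long : states < length ts
        long = ≤-trans (length-power (sym c) N _)
                 (≤-trans (≤-reflexive (cong length (≡-sym (reads zero)))) (tape-length zero ts))

        open Cycle (find-cycle ts run long)

        -- letters read from tape i before the cycle, in the cycle, and the rest of the padding
        a b t len : Fin (suc n) → ℕ
        a i = length (tape i before)
        b i = length (tape i loop)
        t i = N ∸ (a i + b i)
        len i = a i + t i

        prefix-length : ∀ i → length (tape i (before ++ loop)) ≡ a i + b i
        prefix-length i = trans (cong length (project-++ part [_] i before loop)) (length-++ (tape i before))

        prefix-short : ∀ i → a i + b i ≤ states
        prefix-short i = ≤-trans (≤-reflexive (≡-sym (prefix-length i)))
                           (≤-trans (tape-length i (before ++ loop)) early)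

        N-split : ∀ i → (a i + b i) + t i ≡ N
        N-split i = m+[n∸m]≡n (m≤n⇒m≤1+n (prefix-short i))

        len+b≡N : ∀ i → len i + b i ≡ N
        len+b≡N i = begin
          (a i + t i) + b i   ≡⟨ +-assoc (a i) (t i) (b i) ⟩
          a i + (t i + b i)   ≡⟨ cong (a i +_) (+-comm (t i) (b i)) ⟩
          a i + (b i + t i)   ≡⟨ ≡-sym (+-assoc (a i) (b i) (t i)) ⟩
          (a i + b i) + t i   ≡⟨ N-split i ⟩
          N                   ∎
          where open ≡-Reasoning

        bounded : ∀ i → len i ≤ N
        bounded i = ≤-trans (m≤m+n (len i) (b i)) (≤-reflexive (len+b≡N i))

        positive : ∀ i → 1 ≤ len i
        positive i = ≤-trans (m<n⇒0<n∸m (s≤s (prefix-short i))) (m≤n+m (t i) (a i))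

        shorter : Σ (Fin (suc n)) λ i → len i < N
        shorter = let i , reads-some = loop-reads in
          i , <-≤-trans (m<m+n (len i) reads-some) (≤-reflexive (len+b≡N i))

        -- The part of the run up to the end of the cycle stays inside the padding.
        reads-before : ∀ i → tape i before ≡ cs (a i)
        reads-before i = prefix-of-power (sym c) (tape i before)
          (≤-trans (m≤m+n (a i) (b i)) (m≤n⇒m≤1+n (prefix-short i)))
          (begin
            tape i before ++ tape i (loop ++ after)   ≡⟨ ≡-sym (project-++ part [_] i before _) ⟩
            tape i (before ++ loop ++ after)          ≡⟨ cong (tape i) (≡-sym split) ⟩
            tape i ts                                 ≡⟨ reads i ⟩
            cs N ++ withDollar (r i)                  ∎)
          where open ≡-Reasoning

        reads-prefix : ∀ i → tape i (before ++ loop) ≡ cs (a i + b i)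
        reads-prefix i = trans
          (prefix-of-power (sym c) (tape i (before ++ loop))
            (≤-trans (≤-reflexive (prefix-length i)) (m≤n⇒m≤1+n (prefix-short i)))
            (begin
              tape i (before ++ loop) ++ tape i after   ≡⟨ ≡-sym (project-++ part [_] i (before ++ loop) after) ⟩
              tape i ((before ++ loop) ++ after)        ≡⟨ cong (tape i) (trans (++-assoc before loop after) (≡-sym split)) ⟩
              tape i ts                                 ≡⟨ reads i ⟩
              cs N ++ withDollar (r i)                  ∎))
          (cong cs (prefix-length i))
          where open ≡-Reasoning

        -- Any other accepted tuple of the same shape is read through the same
        -- cycle; cutting it out yields an accepting run for the shortened tuple.
        transfer : ∀ r′ → DAccepts D (padded c (λ _ → N) r′) → DAccepts D (padded c len r′)
        transfer r′ (q′ , ts′ , run′ , acc′ , tapes′) =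
          q′ , before ++ us , path-++ run-before run-us , acc′ , new-tapes
          where
            reads′ : ∀ i → tape i ts′ ≡ cs N ++ withDollar (r′ i)
            reads′ = padded-reads r′ ts′ tapes′

            W : Fin (suc n) → List (Sym k)
            W i = withDollar (r′ i)

            to-cycle-end : Run start pivot (before ++ loop)
            to-cycle-end = path-++ run-before run-loop

            through-cycle : Σ Trace λ us → (before ++ loop) ++ us ≡ ts′
            through-cycle = run-prefix to-cycle-end run′ λ i → cs (t i) ++ W i , (begin
              tape i (before ++ loop) ++ cs (t i) ++ W i   ≡⟨ cong (_++ cs (t i) ++ W i) (reads-prefix i) ⟩
              cs (a i + b i) ++ cs (t i) ++ W i            ≡⟨ power-++ (sym c) (a i + b i) (t i) (W i) ⟩
              cs ((a i + b i) + t i) ++ W i                ≡⟨ cong (λ m → cs m ++ W i) (N-split i) ⟩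
              cs N ++ W i                                  ≡⟨ ≡-sym (reads′ i) ⟩
              tape i ts′                                   ∎)
              where open ≡-Reasoning

            us : Trace
            us = proj₁ through-cycle

            run-us : Run pivot q′ us
            run-us = run-suffix to-cycle-end (subst (Run start q′) (≡-sym (proj₂ through-cycle)) run′)

            reads-us : ∀ i → tape i us ≡ cs (t i) ++ W i
            reads-us i = cancel-power (sym c) (a i + b i) (t i) (begin
              cs (a i + b i) ++ tape i us             ≡⟨ cong (_++ tape i us) (≡-sym (reads-prefix i)) ⟩
              tape i (before ++ loop) ++ tape i us    ≡⟨ ≡-sym (project-++ part [_] i (before ++ loop) us) ⟩
              tape i ((before ++ loop) ++ us)         ≡⟨ cong (tape i) (proj₂ through-cycle) ⟩
              tape i ts′                              ≡⟨ reads′ i ⟩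
              cs N ++ W i                             ≡⟨ cong (λ m → cs m ++ W i) (≡-sym (N-split i)) ⟩
              cs ((a i + b i) + t i) ++ W i           ∎)
              where open ≡-Reasoning

            new-tapes : ∀ i → tape i (before ++ us) ≡ withDollar (lookup (padded c len r′) i)
            new-tapes i = begin
              tape i (before ++ us)                     ≡⟨ project-++ part [_] i before us ⟩
              tape i before ++ tape i us                ≡⟨ cong₂ _++_ (reads-before i) (reads-us i) ⟩
              cs (a i) ++ cs (t i) ++ W i               ≡⟨ power-++ (sym c) (a i) (t i) (W i) ⟩
              cs (len i) ++ W i                         ≡⟨ ≡-sym (padded-tape c len r′ i) ⟩
              withDollar (lookup (padded c len r′) i)   ∎
              where open ≡-Reasoning

  shorten : ∀ {c P} → DAccepts D Recognises P → (S : Shortening c) →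
            ∀ r → P (padded c (λ _ → N) r) → P (padded c (Shortening.len S) r)
  shorten recognises S r p = proj₂ (recognises _) (Shortening.transfer S r (proj₁ (recognises _) p))

any-sym? : ∀ {k} {P : Sym k → Set} → (∀ a → Dec (P a)) → Dec (Σ (Sym k) P)
any-sym? {k} {P} P? = map′ join-cases split-cases (FinP.any? (P? ∘ sym) ⊎-dec P? dollar)
  where
    join-cases : (Σ (Fin k) (P ∘ sym)) ⊎ P dollar → Σ (Sym k) P
    join-cases (inj₁ (c , p)) = sym c , p
    join-cases (inj₂ p)       = dollar , p
    split-cases : Σ (Sym k) P → (Σ (Fin k) (P ∘ sym)) ⊎ P dollar
    split-cases (sym c , p)  = inj₁ (c , p)
    split-cases (dollar , p) = inj₂ p

from-does : ∀ {A : Set} (a? : Dec A) → does a? ≡ true → A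
from-does (yes a) _ = a

-- An SAA for (∃x₁) P runs the deterministic
-- automaton D for P, replacing each transition from a state of tape x₁ by
-- an ε-transition that guesses the letter D would read there.  A flag
-- records whether the guessed word has already been closed by $: after
-- that no x₁-letter may be guessed, and only then may the run accept.
module ExistentialProjection {k m : ℕ} (D : DSAA k (suc (suc m))) where
  open DSAA D renaming (start to initial; accept to accepting)
  open Deterministic D

  -- configurations: (x₁ closed? , state of D)
  Config : Set
  Config = Bool × Fin states

  closes : Sym k → Bool
  closes (sym _) = false
  closes dollar  = true

  Guess : Config → Maybe (Sym k) → Config → Set
  Guess (closed , q) nothing  (closed′ , q′) =
    part q ≡ zero × closed ≡ false × Σ (Sym k) λ a → δ q a ≡ just q′ × closed′ ≡ closes a
  Guess (closed , q) (just a) (closed′ , q′) =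
    part q ≢ zero × δ q a ≡ just q′ × closed′ ≡ closed

  _≟ₘ_ : (x y : Maybe (Fin states)) → Dec (x ≡ y)
  _≟ₘ_ = MaybeP.≡-dec _≟_

  guess? : ∀ c l c′ → Dec (Guess c l c′)
  guess? (closed , q) nothing (closed′ , q′) =
    (part q ≟ zero) ×-dec (closed BoolP.≟ false) ×-dec
    any-sym? (λ a → (δ q a ≟ₘ just q′) ×-dec (closed′ BoolP.≟ closes a))
  guess? (closed , q) (just a) (closed′ , q′) =
    ¬? (part q ≟ zero) ×-dec (δ q a ≟ₘ just q′) ×-dec (closed′ BoolP.≟ closed)

  _≟ᶜ_ : (c c′ : Config) → Dec (c ≡ c′)
  _≟ᶜ_ = ProdP.≡-dec BoolP._≟_ _≟_

  encode : Config → Fin (states + states)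
  encode (false , q) = join states states (inj₁ q)
  encode (true  , q) = join states states (inj₂ q)

  decode : Fin (states + states) → Config
  decode x = [ (false ,_) , (true ,_) ]′ (splitAt states x)

  decode-encode : ∀ c → decode (encode c) ≡ c
  decode-encode (false , q) = cong [ (false ,_) , (true ,_) ]′ (FinP.splitAt-join states states (inj₁ q))
  decode-encode (true  , q) = cong [ (false ,_) , (true ,_) ]′ (FinP.splitAt-join states states (inj₂ q))

  -- tape x_(j+1) of D is tape x_j of the SAA (x₁-states only make ε-moves)
  shift : Fin (suc (suc m)) → Fin (suc m)
  shift zero    = zero
  shift (suc j) = j

  guesser : SAA k (suc m)
  guesser = record
    { states = states + states
    ; start  = λ x → does (decode x ≟ᶜ (false , initial))
    ; trans  = λ x l y → does (guess? (decode x) l (decode y))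
    ; accept = λ x → proj₁ (decode x) ∧ accepting (proj₂ (decode x))
    ; part   = λ x → shift (part (proj₂ (decode x)))
    }

  guess-step : ∀ {c l c′} → Guess c l c′ → NStep guesser (encode c) l (encode c′)
  guess-step {c} {l} {c′} g = dec-true (guess? _ l _)
    (subst₂ (λ d d′ → Guess d l d′) (≡-sym (decode-encode c)) (≡-sym (decode-encode c′)) g)

  GTrace : Set
  GTrace = List (Fin (states + states) × Maybe (Sym k))

  gtape : Fin (suc m) → GTrace → List (Sym k)
  gtape = project (SAA.part guesser) labelOf

  Agree : Trace → GTrace → Set
  Agree tsD tsG = ∀ j → tape (suc j) tsD ≡ gtape j tsG

  agree-silent : ∀ {q a x tsD tsG} → part q ≡ zero → Agree tsD tsG →
                 Agree ((q , a) ∷ tsD) ((x , nothing) ∷ tsG)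
  agree-silent {tsD = tsD} {tsG} x₁ agree j = begin
    tape (suc j) (_ ∷ tsD)  ≡⟨ project-elsewhere part [_] tsD (λ e → FinP.0≢1+n (trans (≡-sym x₁) e)) ⟩
    tape (suc j) tsD        ≡⟨ agree j ⟩
    gtape j tsG             ≡⟨ ≡-sym (project-silent (SAA.part guesser) labelOf tsG refl) ⟩
    gtape j (_ ∷ tsG)       ∎
    where open ≡-Reasoning

  unshift : ∀ {t j} → t ≢ zero → shift t ≡ j → t ≡ suc j
  unshift {zero}  not-x₁ _ = ⊥-elim (not-x₁ refl)
  unshift {suc _} _      e = cong suc e

  agree-letter : ∀ {q a x tsD tsG} → part q ≢ zero → SAA.part guesser x ≡ shift (part q) →
                 Agree tsD tsG → Agree ((q , a) ∷ tsD) ((x , just a) ∷ tsG)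
  agree-letter not-x₁ tape-of-x agree j =
    project-cons-cong {part = part} {SAA.part guesser} {[_]} {labelOf} {i = suc j} {j}
    (λ e → trans tape-of-x (cong shift e)) (λ e → unshift not-x₁ (trans (≡-sym tape-of-x) e)) refl (agree j)

  -- What D reads from x₁ from some point of a run on: a whole word w $ while
  -- the flag is open, nothing once it is closed.
  X₁-rest : Bool → List (Sym k) → Set
  X₁-rest false xs = Σ (List (Fin k)) λ w → xs ≡ withDollar w
  X₁-rest true  xs = xs ≡ []

  X₁-rest-cons : ∀ a {xs} → X₁-rest (closes a) xs → X₁-rest false (a ∷ xs)
  X₁-rest-cons (sym c) (w , refl) = c ∷ w , refl
  X₁-rest-cons dollar  refl       = [] , refl

  X₁-rest-uncons : ∀ {closed} a xs → X₁-rest closed (a ∷ xs) → closed ≡ false × X₁-rest (closes a) xs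
  X₁-rest-uncons {false} .dollar  .[] ([] , refl)    = refl , refl
  X₁-rest-uncons {false} .(sym c) _   (c ∷ w , refl) = refl , w , refl
  X₁-rest-uncons {true}  _        _   ()

  Simulated : Config → Fin states → GTrace → Set
  Simulated (closed , q) qf tsG =
    Σ Trace λ tsD → Run q qf tsD × X₁-rest closed (tape zero tsD) × Agree tsD tsG

  simulate-step : ∀ {c l c′ x qf tsG} → Guess c l c′ → SAA.part guesser x ≡ shift (part (proj₂ c)) →
                  Simulated c′ qf tsG → Simulated c qf ((x , l) ∷ tsG)
  simulate-step {_ , q} {nothing} (x₁ , refl , a , step , refl) _ (tsD , run , rest , agree) =
    (q , a) ∷ tsD , cons step run ,
    subst (X₁-rest false) (≡-sym (project-here part [_] tsD x₁)) (X₁-rest-cons a rest) ,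
    agree-silent x₁ agree
  simulate-step {closed , q} {just a} (not-x₁ , step , refl) tape-of-x (tsD , run , rest , agree) =
    (q , a) ∷ tsD , cons step run ,
    subst (X₁-rest closed) (≡-sym (project-elsewhere part [_] tsD not-x₁)) rest ,
    agree-letter not-x₁ tape-of-x agree

  sound : ∀ {x y tsG} → Path (NStep guesser) x y tsG → proj₁ (decode y) ≡ true →
          Simulated (decode x) (proj₂ (decode y)) tsG
  sound nil closed = [] , nil , subst (λ c → X₁-rest c []) (≡-sym closed) refl , λ _ → refl
  sound (cons step path) closed = simulate-step (from-does (guess? _ _ _) step) refl (sound path closed)

  complete : ∀ {q qf tsD} closed → Run q qf tsD → X₁-rest closed (tape zero tsD) →
             Σ GTrace λ tsG → Path (NStep guesser) (encode (closed , q)) (encode (true , qf)) tsG × Agree tsD tsG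
  complete true  nil        _        = [] , nil , λ _ → refl
  complete false nil        ([] , ())
  complete false nil        (_ ∷ _ , ())
  complete {q} closed (cons {l = a} {q' = q′} {ts = tsD} step run) rest with part q ≟ zero
  ... | yes x₁ =
    let closed≡false , rest′ = X₁-rest-uncons a _ rest
        tsG , path , agree = complete (closes a) run rest′
    in (encode (closed , q) , nothing) ∷ tsG ,
       cons (guess-step {l = nothing} {c′ = closes a , q′} (x₁ , closed≡false , a , step , refl)) path , agree-silent x₁ agree
  ... | no not-x₁ =
    let tsG , path , agree = complete closed run rest
    in (encode (closed , q) , just a) ∷ tsG ,
       cons (guess-step {l = just a} {c′ = closed , q′} (not-x₁ , step , refl)) path ,
       agree-letter not-x₁ (cong (shift ∘ part ∘ proj₂) (decode-encode (closed , q))) agree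

  weakly-regular : ∀ {P} → DAccepts D Recognises P → NAccepts guesser Recognises ∃₁ P
  weakly-regular {P} recognises ws = to , from
    where
      to : ∃₁ P ws → NAccepts guesser ws
      to (x , p) =
        let qf , tsD , run , acc , tapes = proj₁ (recognises (x ∷ ws)) p
            tsG , path , agree = complete false run (x , tapes zero)
        in encode (false , initial) , encode (true , qf) , tsG ,
           dec-true (_ ≟ᶜ _) (decode-encode _) , path ,
           trans (cong (λ c → proj₁ c ∧ accepting (proj₂ c)) (decode-encode (true , qf))) acc ,
           λ j → trans (≡-sym (agree j)) (tapes (suc j))
      from : NAccepts guesser ws → ∃₁ P ws
      from (x₀ , y , tsG , starts , path , acc , tapes) =
        let initial-config = from-does (_ ≟ᶜ _) starts
            tsD , run , (w , x₁-tape) , agree =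
              subst (λ c → Simulated c (proj₂ (decode y)) tsG) initial-config
                    (sound path (BoolP.∧-conicalˡ _ _ acc))
        in w , proj₂ (recognises (w ∷ ws))
                 (proj₂ (decode y) , tsD , run , BoolP.∧-conicalʳ _ _ acc ,
                  λ { zero → x₁-tape ; (suc j) → trans (agree j) (tapes j) })

exists-weakly-regular : (k m : ℕ) (P : Pred k (suc (suc m))) → QuasiRegular P → WeaklyRegular (∃₁ P)
exists-weakly-regular k m P (D , recognises) = guesser , weakly-regular recognises
  where open ExistentialProjection D

pattern 𝚊 = zero
pattern 𝚋 = suc zero

a^_ : ℕ → List (Fin 2)
a^ m = replicate m 𝚊

block : ℕ → ℕ → List (Fin 2)
block i j = a^ i ++ 𝚋 ∷ a^ j

power-injective : ∀ {m m′} → a^ m ≡ a^ m′ → m ≡ m′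
power-injective {m} {m′} e = trans (≡-sym (length-replicate m)) (trans (cong length e) (length-replicate m′))

powers-injective : ∀ m z {i} → a^ m ++ a^ z ≡ a^ i → m + z ≡ i
powers-injective m z e = power-injective (trans (replicate-+ 𝚊 m z) e)

single-power : ∀ {m i} → a^ m ++ [] ≡ a^ i → m ≡ i
single-power {m} e = power-injective (trans (≡-sym (++-identityʳ (a^ m))) e)

block-injective : ∀ {i j i′ j′} → block i j ≡ block i′ j′ → i ≡ i′ × j ≡ j′
block-injective {zero}  {i′ = zero}   e = refl , power-injective (∷-injectiveʳ e)
block-injective {suc i} {i′ = suc i′} e = let i≡ , j≡ = block-injective (∷-injectiveʳ e) in cong suc i≡ , j≡
block-injective {zero}  {i′ = suc _}  e with ∷-injectiveˡ e
... | ()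
block-injective {suc _} {i′ = zero}   e with ∷-injectiveˡ e
... | ()

withDollar-injective : ∀ {k} {u v : List (Fin k)} → withDollar u ≡ withDollar v → u ≡ v
withDollar-injective {u = u} {v} e = map-injective sym-injective (++-cancelʳ _ (map sym u) (map sym v) e)
  where
    sym-injective : ∀ {k} {x y : Fin k} → sym x ≡ sym y → x ≡ y
    sym-injective refl = refl

LeftCopy : Pred 2 2
LeftCopy (u ∷ v ∷ []) = Σ ℕ λ i → Σ ℕ λ j → u ≡ block i j × v ≡ a^ i

RightCopy : Pred 2 2
RightCopy (u ∷ v ∷ []) = Σ ℕ λ i → Σ ℕ λ j → u ≡ block i j × v ≡ a^ j

module TwoTapes (D : DSAA 2 2) where
  open Pumping D public

  not-both-full : (S : Shortening 𝚊) → Shortening.len S 𝚊 ≡ N → Shortening.len S 𝚋 ≡ N → ⊥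
  not-both-full S e₀ e₁ with Shortening.shorter S
  ... | 𝚊 , shorter = <-irrefl e₀ shorter
  ... | 𝚋 , shorter = <-irrefl e₁ shorter

-- Part (b).  (aᴺ b aᴺ , aᴺ) lies in LeftCopy ∧ RightCopy; a shortening of
-- its paddings stays in LeftCopy ∧ RightCopy only if both stay at length N.
intersection-not-quasi-regular : ¬ QuasiRegular (LeftCopy ∧ₚ RightCopy)
intersection-not-quasi-regular (D , recognises) = leaves (shorten recognises S r in-both)
  where
    open TwoTapes D

    r : Fin 2 → List (Fin 2)
    r 𝚊 = 𝚋 ∷ a^ N
    r 𝚋 = []

    in-both : (LeftCopy ∧ₚ RightCopy) (padded 𝚊 (λ _ → N) r)
    in-both = (N , N , refl , ++-identityʳ _) , (N , N , refl , ++-identityʳ _)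

    S : Shortening 𝚊
    S = pump-down 𝚊 r (proj₁ (recognises _) in-both)
    open Shortening S

    leaves : ¬ (LeftCopy ∧ₚ RightCopy) (padded 𝚊 len r)
    leaves ((i , _ , eu , ev) , (_ , j′ , eu′ , ev′)) = not-both-full S len₀≡N len₁≡N
      where
        len₁≡N : len 𝚋 ≡ N
        len₁≡N = trans (single-power ev′) (≡-sym (proj₂ (block-injective eu′)))
        len₀≡N : len 𝚊 ≡ N
        len₀≡N = trans (proj₁ (block-injective eu)) (trans (≡-sym (single-power ev)) len₁≡N)

-- Shortening (aᴺ b a²ᴺ , a²ᴺ) ∈ RightCopy forces the second
-- padding to stay full, since the shortened pair cannot lie in LeftCopy;
-- then shortening (aᴺ b a²ᴺ , aᴺ) ∈ LeftCopy leaves LeftCopy ∨ RightCopy.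
union-not-quasi-regular : ¬ QuasiRegular (LeftCopy ∨ₚ RightCopy)
union-not-quasi-regular (D , recognises) = leaves (shorten recognises S for-left in-left)
  where
    open TwoTapes D

    for-left for-right : Fin 2 → List (Fin 2)
    for-left 𝚊  = 𝚋 ∷ a^ (N + N)
    for-left 𝚋  = []
    for-right 𝚊 = 𝚋 ∷ a^ (N + N)
    for-right 𝚋 = a^ N

    in-left : (LeftCopy ∨ₚ RightCopy) (padded 𝚊 (λ _ → N) for-left)
    in-left = inj₁ (N , N + N , refl , ++-identityʳ _)

    in-right : (LeftCopy ∨ₚ RightCopy) (padded 𝚊 (λ _ → N) for-right)
    in-right = inj₂ (N , N + N , refl , ≡-sym (replicate-+ 𝚊 N N))

    S : Shortening 𝚊
    S = pump-down 𝚊 for-right (proj₁ (recognises _) in-right)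
    open Shortening S

    stays-full : (LeftCopy ∨ₚ RightCopy) (padded 𝚊 len for-right) → len 𝚋 ≡ N
    stays-full (inj₁ (i , _ , eu , ev)) = ⊥-elim (1+n≰n (begin
      suc N        ≤⟨ +-monoˡ-≤ N (positive 𝚋) ⟩
      len 𝚋 + N    ≡⟨ powers-injective (len 𝚋) N ev ⟩
      i            ≡⟨ ≡-sym (proj₁ (block-injective eu)) ⟩
      len 𝚊        ≤⟨ bounded 𝚊 ⟩
      N            ∎))
      where open ≤-Reasoning
    stays-full (inj₂ (_ , j , eu , ev)) =
      +-cancelʳ-≡ N (len 𝚋) N (trans (powers-injective (len 𝚋) N ev) (≡-sym (proj₂ (block-injective eu))))

    len₁≡N : len 𝚋 ≡ N
    len₁≡N = stays-full (shorten recognises S for-right in-right)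

    leaves : ¬ (LeftCopy ∨ₚ RightCopy) (padded 𝚊 len for-left)
    leaves (inj₁ (i , _ , eu , ev)) =
      not-both-full S (trans (proj₁ (block-injective eu)) (trans (≡-sym (single-power ev)) len₁≡N)) len₁≡N
    leaves (inj₂ (_ , j , eu , ev)) =
      m+1+n≰m N (≤-reflexive (trans (proj₂ (block-injective eu)) (trans (≡-sym (single-power ev)) len₁≡N)))

-- States are named by pattern synonyms; the verification
-- of each automaton describes, for every state, what an accepting run from
-- it still reads from the tapes (soundness, by induction on the run), and
-- constructs the accepting runs (completeness).
pattern q0 = zero
pattern q1 = suc q0
pattern q2 = suc q1
pattern q3 = suc q2
pattern q4 = suc q3
pattern q5 = suc q4
pattern q6 = suc q5
pattern q7 = suc q6
pattern q8 = suc q7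
pattern q9 = suc q8
pattern q10 = suc q9
pattern q11 = suc q10

pattern sa = sym 𝚊
pattern sb = sym 𝚋

-- LeftCopy: alternately read an a from u and from v; on b in u, close v
-- with $, then read the rest a* $ of u.
left-δ : Fin 5 → Sym 2 → Maybe (Fin 5)
left-δ q0 sa     = just q1
left-δ q0 sb     = just q2
left-δ q1 sa     = just q0
left-δ q2 dollar = just q3
left-δ q3 sa     = just q3
left-δ q3 dollar = just q4
left-δ _  _      = nothing

left-part : Fin 5 → Fin 2
left-part q1 = 𝚋
left-part q2 = 𝚋
left-part _  = 𝚊

final-q4 : Fin 5 → Bool
final-q4 q4 = true
final-q4 _  = false

left-automaton : DSAA 2 2
left-automaton = record { states = 5 ; start = q0 ; δ = left-δ ; accept = final-q4 ; part = left-part }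

module LeftCopyAutomaton where
  open Deterministic left-automaton

  Reads : Trace → List (Sym 2) → List (Sym 2) → Set
  Reads ts U V = tape 𝚊 ts ≡ U × tape 𝚋 ts ≡ V

  Remaining : Fin 5 → Trace → Set
  Remaining q0 ts = Σ ℕ λ i → Σ ℕ λ j → Reads ts (withDollar (block i j)) (withDollar (a^ i))
  Remaining q1 ts = Σ ℕ λ i → Σ ℕ λ j → Reads ts (withDollar (block i j)) (sa ∷ withDollar (a^ i))
  Remaining q2 ts = Σ ℕ λ j → Reads ts (withDollar (a^ j)) (dollar ∷ [])
  Remaining q3 ts = Σ ℕ λ j → Reads ts (withDollar (a^ j)) []
  Remaining q4 ts = Reads ts [] []

  sound : ∀ {q f ts} → Run q f ts → final-q4 f ≡ true → Remaining q ts
  sound {q4} nil _ = refl , refl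
  sound (cons {q = q0} {l = sa} refl p) acc =
    let i , j , eu , ev = sound p acc in suc i , j , cong (sa ∷_) eu , ev
  sound (cons {q = q0} {l = sb} refl p) acc =
    let j , eu , ev = sound p acc in zero , j , cong (sb ∷_) eu , ev
  sound (cons {q = q1} {l = sa} refl p) acc =
    let i , j , eu , ev = sound p acc in i , j , eu , cong (sa ∷_) ev
  sound (cons {q = q2} {l = dollar} refl p) acc =
    let j , eu , ev = sound p acc in j , eu , cong (dollar ∷_) ev
  sound (cons {q = q3} {l = sa} refl p) acc =
    let j , eu , ev = sound p acc in suc j , cong (sa ∷_) eu , ev
  sound (cons {q = q3} {l = dollar} refl p) acc =
    let eu , ev = sound p acc in zero , cong (dollar ∷_) eu , ev
  sound {q0} nil ()
  sound {q1} nil ()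
  sound {q2} nil ()
  sound {q3} nil ()
  sound (cons {q = q0} {l = dollar} () _) _
  sound (cons {q = q1} {l = sb}     () _) _
  sound (cons {q = q1} {l = dollar} () _) _
  sound (cons {q = q2} {l = sa}     () _) _
  sound (cons {q = q2} {l = sb}     () _) _
  sound (cons {q = q3} {l = sb}     () _) _
  sound (cons {q = q4}              () _) _

  run-q3 : ∀ j → Σ Trace λ ts → Run q3 q4 ts × Reads ts (withDollar (a^ j)) []
  run-q3 zero    = (q3 , dollar) ∷ [] , cons refl nil , refl , refl
  run-q3 (suc j) = let ts , p , eu , ev = run-q3 j in (q3 , sa) ∷ ts , cons refl p , cong (sa ∷_) eu , ev

  run-q0 : ∀ i j → Σ Trace λ ts → Run q0 q4 ts × Reads ts (withDollar (block i j)) (withDollar (a^ i))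
  run-q0 zero j =
    let ts , p , eu , ev = run-q3 j in
    (q0 , sb) ∷ (q2 , dollar) ∷ ts , cons refl (cons refl p) , cong (sb ∷_) eu , cong (dollar ∷_) ev
  run-q0 (suc i) j =
    let ts , p , eu , ev = run-q0 i j in
    (q0 , sa) ∷ (q1 , sa) ∷ ts , cons refl (cons refl p) , cong (sa ∷_) eu , cong (sa ∷_) ev

  quasi-regular : QuasiRegular LeftCopy
  quasi-regular = left-automaton , λ { (u ∷ v ∷ []) → complete u v , sound-at-start u v }
    where
      complete : ∀ u v → LeftCopy (u ∷ v ∷ []) → DAccepts left-automaton (u ∷ v ∷ [])
      complete _ _ (i , j , refl , refl) =
        let ts , p , eu , ev = run-q0 i j in q4 , ts , p , refl , λ { 𝚊 → eu ; 𝚋 → ev }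
      sound-at-start : ∀ u v → DAccepts left-automaton (u ∷ v ∷ []) → LeftCopy (u ∷ v ∷ [])
      sound-at-start u v (_ , _ , p , acc , tapes) =
        let i , j , eu , ev = sound p acc in
        i , j , withDollar-injective (trans (≡-sym (tapes 𝚊)) eu) , withDollar-injective (trans (≡-sym (tapes 𝚋)) ev)

-- RightCopy: read aⁱ b from u, then alternately an a from u and from v,
-- and finally $ from u and $ from v.
right-δ : Fin 5 → Sym 2 → Maybe (Fin 5)
right-δ q0 sa     = just q0
right-δ q0 sb     = just q1
right-δ q1 sa     = just q2
right-δ q1 dollar = just q3
right-δ q2 sa     = just q1
right-δ q3 dollar = just q4
right-δ _  _      = nothing

right-part : Fin 5 → Fin 2
right-part q2 = 𝚋
right-part q3 = 𝚋
right-part _  = 𝚊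

right-automaton : DSAA 2 2
right-automaton = record { states = 5 ; start = q0 ; δ = right-δ ; accept = final-q4 ; part = right-part }

module RightCopyAutomaton where
  open Deterministic right-automaton

  Reads : Trace → List (Sym 2) → List (Sym 2) → Set
  Reads ts U V = tape 𝚊 ts ≡ U × tape 𝚋 ts ≡ V

  Remaining : Fin 5 → Trace → Set
  Remaining q0 ts = Σ ℕ λ i → Σ ℕ λ j → Reads ts (withDollar (block i j)) (withDollar (a^ j))
  Remaining q1 ts = Σ ℕ λ j → Reads ts (withDollar (a^ j)) (withDollar (a^ j))
  Remaining q2 ts = Σ ℕ λ j → Reads ts (withDollar (a^ j)) (sa ∷ withDollar (a^ j))
  Remaining q3 ts = Reads ts [] (dollar ∷ [])
  Remaining q4 ts = Reads ts [] []

  sound : ∀ {q f ts} → Run q f ts → final-q4 f ≡ true → Remaining q ts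
  sound {q4} nil _ = refl , refl
  sound (cons {q = q0} {l = sa} refl p) acc =
    let i , j , eu , ev = sound p acc in suc i , j , cong (sa ∷_) eu , ev
  sound (cons {q = q0} {l = sb} refl p) acc =
    let j , eu , ev = sound p acc in zero , j , cong (sb ∷_) eu , ev
  sound (cons {q = q1} {l = sa} refl p) acc =
    let j , eu , ev = sound p acc in suc j , cong (sa ∷_) eu , ev
  sound (cons {q = q1} {l = dollar} refl p) acc =
    let eu , ev = sound p acc in zero , cong (dollar ∷_) eu , ev
  sound (cons {q = q2} {l = sa} refl p) acc =
    let j , eu , ev = sound p acc in j , eu , cong (sa ∷_) ev
  sound (cons {q = q3} {l = dollar} refl p) acc =
    let eu , ev = sound p acc in eu , cong (dollar ∷_) ev
  sound {q0} nil ()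
  sound {q1} nil ()
  sound {q2} nil ()
  sound {q3} nil ()
  sound (cons {q = q0} {l = dollar} () _) _
  sound (cons {q = q1} {l = sb}     () _) _
  sound (cons {q = q2} {l = sb}     () _) _
  sound (cons {q = q2} {l = dollar} () _) _
  sound (cons {q = q3} {l = sa}     () _) _
  sound (cons {q = q3} {l = sb}     () _) _
  sound (cons {q = q4}              () _) _

  run-q1 : ∀ j → Σ Trace λ ts → Run q1 q4 ts × Reads ts (withDollar (a^ j)) (withDollar (a^ j))
  run-q1 zero    = (q1 , dollar) ∷ (q3 , dollar) ∷ [] , cons refl (cons refl nil) , refl , refl
  run-q1 (suc j) =
    let ts , p , eu , ev = run-q1 j in
    (q1 , sa) ∷ (q2 , sa) ∷ ts , cons refl (cons refl p) , cong (sa ∷_) eu , cong (sa ∷_) ev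

  run-q0 : ∀ i j → Σ Trace λ ts → Run q0 q4 ts × Reads ts (withDollar (block i j)) (withDollar (a^ j))
  run-q0 zero    j = let ts , p , eu , ev = run-q1 j in (q0 , sb) ∷ ts , cons refl p , cong (sb ∷_) eu , ev
  run-q0 (suc i) j = let ts , p , eu , ev = run-q0 i j in (q0 , sa) ∷ ts , cons refl p , cong (sa ∷_) eu , ev

  quasi-regular : QuasiRegular RightCopy
  quasi-regular = right-automaton , λ { (u ∷ v ∷ []) → complete u v , sound-at-start u v }
    where
      complete : ∀ u v → RightCopy (u ∷ v ∷ []) → DAccepts right-automaton (u ∷ v ∷ [])
      complete _ _ (i , j , refl , refl) =
        let ts , p , eu , ev = run-q0 i j in q4 , ts , p , refl , λ { 𝚊 → eu ; 𝚋 → ev }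
      sound-at-start : ∀ u v → DAccepts right-automaton (u ∷ v ∷ []) → RightCopy (u ∷ v ∷ [])
      sound-at-start u v (_ , _ , p , acc , tapes) =
        let i , j , eu , ev = sound p acc in
        i , j , withDollar-injective (trans (≡-sym (tapes 𝚊)) eu) , withDollar-injective (trans (≡-sym (tapes 𝚋)) ev)

Switch : Pred 2 3
Switch (x ∷ u ∷ v ∷ []) = (x ≡ [] × LeftCopy (u ∷ v ∷ [])) ⊎ (x ≢ [] × RightCopy (u ∷ v ∷ []))

pattern 𝚡 = zero
pattern 𝚞 = suc zero
pattern 𝚟 = suc (suc zero)

-- Read x; if it is empty continue as the LeftCopy automaton (states 2-5),
-- otherwise as the RightCopy automaton (states 7-10); both end in state 6.
switch-δ : Fin 11 → Sym 2 → Maybe (Fin 11)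
switch-δ q0  sa     = just q1
switch-δ q0  sb     = just q1
switch-δ q0  dollar = just q2
switch-δ q1  sa     = just q1
switch-δ q1  sb     = just q1
switch-δ q1  dollar = just q7
switch-δ q2  sa     = just q3
switch-δ q2  sb     = just q4
switch-δ q3  sa     = just q2
switch-δ q4  dollar = just q5
switch-δ q5  sa     = just q5
switch-δ q5  dollar = just q6
switch-δ q7  sa     = just q7
switch-δ q7  sb     = just q8
switch-δ q8  sa     = just q9
switch-δ q8  dollar = just q10
switch-δ q9  sa     = just q8
switch-δ q10 dollar = just q6
switch-δ _   _      = nothing

switch-part : Fin 11 → Fin 3
switch-part q2  = 𝚞
switch-part q3  = 𝚟
switch-part q4  = 𝚟
switch-part q5  = 𝚞
switch-part q7  = 𝚞
switch-part q8  = 𝚞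
switch-part q9  = 𝚟
switch-part q10 = 𝚟
switch-part _   = 𝚡

final-q6 : Fin 11 → Bool
final-q6 q6 = true
final-q6 _  = false

switch-automaton : DSAA 2 3
switch-automaton = record { states = 11 ; start = q0 ; δ = switch-δ ; accept = final-q6 ; part = switch-part }

module SwitchAutomaton where
  open Deterministic switch-automaton

  Reads : Trace → List (Sym 2) → List (Sym 2) → List (Sym 2) → Set
  Reads ts X U V = tape 𝚡 ts ≡ X × tape 𝚞 ts ≡ U × tape 𝚟 ts ≡ V

  Remaining : Fin 11 → Trace → Set
  Remaining q0  ts = (Σ ℕ λ i → Σ ℕ λ j → Reads ts (dollar ∷ []) (withDollar (block i j)) (withDollar (a^ i)))
                   ⊎ (Σ (Fin 2) λ c → Σ (List (Fin 2)) λ x → Σ ℕ λ i → Σ ℕ λ j →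
                        Reads ts (withDollar (c ∷ x)) (withDollar (block i j)) (withDollar (a^ j)))
  Remaining q1  ts = Σ (List (Fin 2)) λ x → Σ ℕ λ i → Σ ℕ λ j →
                       Reads ts (withDollar x) (withDollar (block i j)) (withDollar (a^ j))
  Remaining q2  ts = Σ ℕ λ i → Σ ℕ λ j → Reads ts [] (withDollar (block i j)) (withDollar (a^ i))
  Remaining q3  ts = Σ ℕ λ i → Σ ℕ λ j → Reads ts [] (withDollar (block i j)) (sa ∷ withDollar (a^ i))
  Remaining q4  ts = Σ ℕ λ j → Reads ts [] (withDollar (a^ j)) (dollar ∷ [])
  Remaining q5  ts = Σ ℕ λ j → Reads ts [] (withDollar (a^ j)) []
  Remaining q6  ts = Reads ts [] [] []
  Remaining q7  ts = Σ ℕ λ i → Σ ℕ λ j → Reads ts [] (withDollar (block i j)) (withDollar (a^ j))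
  Remaining q8  ts = Σ ℕ λ j → Reads ts [] (withDollar (a^ j)) (withDollar (a^ j))
  Remaining q9  ts = Σ ℕ λ j → Reads ts [] (withDollar (a^ j)) (sa ∷ withDollar (a^ j))
  Remaining q10 ts = Reads ts [] [] (dollar ∷ [])

  sound : ∀ {q f ts} → Run q f ts → final-q6 f ≡ true → Remaining q ts
  sound {q6} nil _ = refl , refl , refl
  sound (cons {q = q0} {l = sa} refl p) acc =
    let x , i , j , ex , eu , ev = sound p acc in inj₂ (𝚊 , x , i , j , cong (sa ∷_) ex , eu , ev)
  sound (cons {q = q0} {l = sb} refl p) acc =
    let x , i , j , ex , eu , ev = sound p acc in inj₂ (𝚋 , x , i , j , cong (sb ∷_) ex , eu , ev)
  sound (cons {q = q0} {l = dollar} refl p) acc =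
    let i , j , ex , eu , ev = sound p acc in inj₁ (i , j , cong (dollar ∷_) ex , eu , ev)
  sound (cons {q = q1} {l = sa} refl p) acc =
    let x , i , j , ex , eu , ev = sound p acc in 𝚊 ∷ x , i , j , cong (sa ∷_) ex , eu , ev
  sound (cons {q = q1} {l = sb} refl p) acc =
    let x , i , j , ex , eu , ev = sound p acc in 𝚋 ∷ x , i , j , cong (sb ∷_) ex , eu , ev
  sound (cons {q = q1} {l = dollar} refl p) acc =
    let i , j , ex , eu , ev = sound p acc in [] , i , j , cong (dollar ∷_) ex , eu , ev
  sound (cons {q = q2} {l = sa} refl p) acc =
    let i , j , ex , eu , ev = sound p acc in suc i , j , ex , cong (sa ∷_) eu , ev
  sound (cons {q = q2} {l = sb} refl p) acc =
    let j , ex , eu , ev = sound p acc in zero , j , ex , cong (sb ∷_) eu , ev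
  sound (cons {q = q3} {l = sa} refl p) acc =
    let i , j , ex , eu , ev = sound p acc in i , j , ex , eu , cong (sa ∷_) ev
  sound (cons {q = q4} {l = dollar} refl p) acc =
    let j , ex , eu , ev = sound p acc in j , ex , eu , cong (dollar ∷_) ev
  sound (cons {q = q5} {l = sa} refl p) acc =
    let j , ex , eu , ev = sound p acc in suc j , ex , cong (sa ∷_) eu , ev
  sound (cons {q = q5} {l = dollar} refl p) acc =
    let ex , eu , ev = sound p acc in zero , ex , cong (dollar ∷_) eu , ev
  sound (cons {q = q7} {l = sa} refl p) acc =
    let i , j , ex , eu , ev = sound p acc in suc i , j , ex , cong (sa ∷_) eu , ev
  sound (cons {q = q7} {l = sb} refl p) acc =
    let j , ex , eu , ev = sound p acc in zero , j , ex , cong (sb ∷_) eu , ev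
  sound (cons {q = q8} {l = sa} refl p) acc =
    let j , ex , eu , ev = sound p acc in suc j , ex , cong (sa ∷_) eu , ev
  sound (cons {q = q8} {l = dollar} refl p) acc =
    let ex , eu , ev = sound p acc in zero , ex , cong (dollar ∷_) eu , ev
  sound (cons {q = q9} {l = sa} refl p) acc =
    let j , ex , eu , ev = sound p acc in j , ex , eu , cong (sa ∷_) ev
  sound (cons {q = q10} {l = dollar} refl p) acc =
    let ex , eu , ev = sound p acc in ex , eu , cong (dollar ∷_) ev
  sound {q0}  nil ()
  sound {q1}  nil ()
  sound {q2}  nil ()
  sound {q3}  nil ()
  sound {q4}  nil ()
  sound {q5}  nil ()
  sound {q7}  nil ()
  sound {q8}  nil ()
  sound {q9}  nil ()
  sound {q10} nil ()
  sound (cons {q = q2}  {l = dollar} () _) _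
  sound (cons {q = q3}  {l = sb}     () _) _
  sound (cons {q = q3}  {l = dollar} () _) _
  sound (cons {q = q4}  {l = sa}     () _) _
  sound (cons {q = q4}  {l = sb}     () _) _
  sound (cons {q = q5}  {l = sb}     () _) _
  sound (cons {q = q6}               () _) _
  sound (cons {q = q7}  {l = dollar} () _) _
  sound (cons {q = q8}  {l = sb}     () _) _
  sound (cons {q = q9}  {l = sb}     () _) _
  sound (cons {q = q9}  {l = dollar} () _) _
  sound (cons {q = q10} {l = sa}     () _) _
  sound (cons {q = q10} {l = sb}     () _) _

  run-q5 : ∀ j → Σ Trace λ ts → Run q5 q6 ts × Reads ts [] (withDollar (a^ j)) []
  run-q5 zero    = (q5 , dollar) ∷ [] , cons refl nil , refl , refl , refl
  run-q5 (suc j) = let ts , p , ex , eu , ev = run-q5 j in (q5 , sa) ∷ ts , cons refl p , ex , cong (sa ∷_) eu , ev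

  run-q2 : ∀ i j → Σ Trace λ ts → Run q2 q6 ts × Reads ts [] (withDollar (block i j)) (withDollar (a^ i))
  run-q2 zero j =
    let ts , p , ex , eu , ev = run-q5 j in
    (q2 , sb) ∷ (q4 , dollar) ∷ ts , cons refl (cons refl p) , ex , cong (sb ∷_) eu , cong (dollar ∷_) ev
  run-q2 (suc i) j =
    let ts , p , ex , eu , ev = run-q2 i j in
    (q2 , sa) ∷ (q3 , sa) ∷ ts , cons refl (cons refl p) , ex , cong (sa ∷_) eu , cong (sa ∷_) ev

  run-q8 : ∀ j → Σ Trace λ ts → Run q8 q6 ts × Reads ts [] (withDollar (a^ j)) (withDollar (a^ j))
  run-q8 zero    = (q8 , dollar) ∷ (q10 , dollar) ∷ [] , cons refl (cons refl nil) , refl , refl , refl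
  run-q8 (suc j) =
    let ts , p , ex , eu , ev = run-q8 j in
    (q8 , sa) ∷ (q9 , sa) ∷ ts , cons refl (cons refl p) , ex , cong (sa ∷_) eu , cong (sa ∷_) ev

  run-q7 : ∀ i j → Σ Trace λ ts → Run q7 q6 ts × Reads ts [] (withDollar (block i j)) (withDollar (a^ j))
  run-q7 zero    j = let ts , p , ex , eu , ev = run-q8 j in (q7 , sb) ∷ ts , cons refl p , ex , cong (sb ∷_) eu , ev
  run-q7 (suc i) j = let ts , p , ex , eu , ev = run-q7 i j in (q7 , sa) ∷ ts , cons refl p , ex , cong (sa ∷_) eu , ev

  run-q1 : ∀ x i j → Σ Trace λ ts → Run q1 q6 ts × Reads ts (withDollar x) (withDollar (block i j)) (withDollar (a^ j))
  run-q1 [] i j =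
    let ts , p , ex , eu , ev = run-q7 i j in (q1 , dollar) ∷ ts , cons refl p , cong (dollar ∷_) ex , eu , ev
  run-q1 (𝚊 ∷ x) i j =
    let ts , p , ex , eu , ev = run-q1 x i j in (q1 , sa) ∷ ts , cons refl p , cong (sa ∷_) ex , eu , ev
  run-q1 (𝚋 ∷ x) i j =
    let ts , p , ex , eu , ev = run-q1 x i j in (q1 , sb) ∷ ts , cons refl p , cong (sb ∷_) ex , eu , ev

  quasi-regular : QuasiRegular Switch
  quasi-regular = switch-automaton , λ { (x ∷ u ∷ v ∷ []) → complete x u v , sound-at-start x u v }
    where
      accepting : ∀ {x u v ts} → Run q0 q6 ts → Reads ts (withDollar x) (withDollar u) (withDollar v) →
                  DAccepts switch-automaton (x ∷ u ∷ v ∷ [])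
      accepting p (ex , eu , ev) = q6 , _ , p , refl , λ { 𝚡 → ex ; 𝚞 → eu ; 𝚟 → ev }

      complete : ∀ x u v → Switch (x ∷ u ∷ v ∷ []) → DAccepts switch-automaton (x ∷ u ∷ v ∷ [])
      complete .[] _ _ (inj₁ (refl , i , j , refl , refl)) =
        let ts , p , ex , eu , ev = run-q2 i j in accepting (cons refl p) (cong (dollar ∷_) ex , eu , ev)
      complete [] _ _ (inj₂ (x≢[] , _)) = ⊥-elim (x≢[] refl)
      complete (𝚊 ∷ x) _ _ (inj₂ (_ , i , j , refl , refl)) =
        let ts , p , ex , eu , ev = run-q1 x i j in accepting (cons refl p) (cong (sa ∷_) ex , eu , ev)
      complete (𝚋 ∷ x) _ _ (inj₂ (_ , i , j , refl , refl)) =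
        let ts , p , ex , eu , ev = run-q1 x i j in accepting (cons refl p) (cong (sb ∷_) ex , eu , ev)

      sound-at-start : ∀ x u v → DAccepts switch-automaton (x ∷ u ∷ v ∷ []) → Switch (x ∷ u ∷ v ∷ [])
      sound-at-start x u v (_ , ts , p , acc , tapes) = classify (sound p acc)
        where
          read : ∀ {w} t → tape t ts ≡ withDollar w → lookup (x ∷ u ∷ v ∷ []) t ≡ w
          read t e = withDollar-injective (trans (≡-sym (tapes t)) e)

          classify : Remaining q0 ts → Switch (x ∷ u ∷ v ∷ [])
          classify (inj₁ (i , j , ex , eu , ev)) = inj₁ (read 𝚡 ex , i , j , read 𝚞 eu , read 𝚟 ev)
          classify (inj₂ (c , x′ , i , j , ex , eu , ev)) =
            inj₂ ((λ x≡[] → nonempty (trans (≡-sym (read 𝚡 ex)) x≡[])) , i , j , read 𝚞 eu , read 𝚟 ev)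
            where nonempty : c ∷ x′ ≢ []
                  nonempty ()

quasi-regular-resp : ∀ {k n} {P P′ : Pred k n} →
  (∀ ws → P ws → P′ ws) → (∀ ws → P′ ws → P ws) → QuasiRegular P → QuasiRegular P′
quasi-regular-resp P⇒P′ P′⇒P (D , recognises) =
  D , λ ws → (λ p′ → proj₁ (recognises ws) (P′⇒P ws p′)) , (λ acc → P⇒P′ ws (proj₂ (recognises ws) acc))

-- Quantifying the selector away: (∃x) Switch = LeftCopy ∨ RightCopy and
-- (∀x) Switch = LeftCopy ∧ RightCopy (take x = [] and x = a).
a≢[] : _≢_ {A = List (Fin 2)} (𝚊 ∷ []) []
a≢[] ()

exists-switch⇒union : ∀ ws → ∃₁ Switch ws → (LeftCopy ∨ₚ RightCopy) ws
exists-switch⇒union (_ ∷ _ ∷ []) (_ , inj₁ (_ , left))  = inj₁ left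
exists-switch⇒union (_ ∷ _ ∷ []) (_ , inj₂ (_ , right)) = inj₂ right

union⇒exists-switch : ∀ ws → (LeftCopy ∨ₚ RightCopy) ws → ∃₁ Switch ws
union⇒exists-switch (_ ∷ _ ∷ []) (inj₁ left)  = [] , inj₁ (refl , left)
union⇒exists-switch (_ ∷ _ ∷ []) (inj₂ right) = 𝚊 ∷ [] , inj₂ (a≢[] , right)

forall-switch⇒intersection : ∀ ws → ∀₁ Switch ws → (LeftCopy ∧ₚ RightCopy) ws
forall-switch⇒intersection (u ∷ v ∷ []) switch = left (switch []) , right (switch (𝚊 ∷ []))
  where
    left : Switch ([] ∷ u ∷ v ∷ []) → LeftCopy (u ∷ v ∷ [])
    left (inj₁ (_ , l))  = l
    left (inj₂ (x≢[] , _)) = ⊥-elim (x≢[] refl)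
    right : Switch ((𝚊 ∷ []) ∷ u ∷ v ∷ []) → RightCopy (u ∷ v ∷ [])
    right (inj₁ (x≡[] , _)) = ⊥-elim (a≢[] x≡[])
    right (inj₂ (_ , r))  = r

intersection⇒forall-switch : ∀ ws → (LeftCopy ∧ₚ RightCopy) ws → ∀₁ Switch ws
intersection⇒forall-switch (_ ∷ _ ∷ []) (left , _) []      = inj₁ (refl , left)
intersection⇒forall-switch (_ ∷ _ ∷ []) (_ , right) (_ ∷ _) = inj₂ ((λ ()) , right)

exists-not-quasi-regular : ¬ QuasiRegular (∃₁ Switch)
exists-not-quasi-regular qr =
  union-not-quasi-regular (quasi-regular-resp exists-switch⇒union union⇒exists-switch qr)

forall-not-quasi-regular : ¬ QuasiRegular (∀₁ Switch)
forall-not-quasi-regular qr =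
  intersection-not-quasi-regular (quasi-regular-resp forall-switch⇒intersection intersection⇒forall-switch qr)


mainTheorem4 :
    (Σ ℕ λ k → Σ ℕ λ m → Σ (Pred k (suc m)) λ P → Σ (Pred k (suc m)) λ Q →
      QuasiRegular P × QuasiRegular Q × ¬ QuasiRegular (P ∧ₚ Q))
    × (Σ ℕ λ k → Σ ℕ λ m → Σ (Pred k (suc m)) λ P → Σ (Pred k (suc m)) λ Q →
      QuasiRegular P × QuasiRegular Q × ¬ QuasiRegular (P ∨ₚ Q))
    × ((k m : ℕ) (P : Pred k (suc (suc m))) → QuasiRegular P → WeaklyRegular (∃₁ P))
    × (Σ ℕ λ k → Σ ℕ λ m → Σ (Pred k (suc (suc m))) λ P →
      QuasiRegular P × ¬ QuasiRegular (∃₁ P))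
    × (Σ ℕ λ k → Σ ℕ λ m → Σ (Pred k (suc (suc m))) λ P →
      QuasiRegular P × ¬ QuasiRegular (∀₁ P))
mainTheorem4 =
    (2 , 1 , LeftCopy , RightCopy , LeftCopyAutomaton.quasi-regular , RightCopyAutomaton.quasi-regular ,
     intersection-not-quasi-regular)
  , (2 , 1 , LeftCopy , RightCopy , LeftCopyAutomaton.quasi-regular , RightCopyAutomaton.quasi-regular ,
     union-not-quasi-regular)
  , exists-weakly-regular
  , (2 , 1 , Switch , SwitchAutomaton.quasi-regular , exists-not-quasi-regular)
  , (2 , 1 , Switch , SwitchAutomaton.quasi-regular , forall-not-quasi-regular)
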